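{- Let $\Sigma=\{\veebar,\wedge,\vee\}$, let $\Phi=\{p_1,\dots,p_n\}$ and $\varphi,\psi\in\mathrm{PL}(\Sigma,\Phi)$. Then: \begin{itemize} \item $\mathrm{Dim}(\ell)\leq 1$ for every $\Phi$-literal $\ell$; \item $\mathrm{Dim}(\varphi\wedge\psi)\leq\mathrm{Dim}(\varphi)\cdot\mathrm{Dim}(\psi)$; \item $\mathrm{Dim}(\varphi\vee\psi)\leq\mathrm{Dim}(\varphi)\cdot\mathrm{Dim}(\psi)$; \item $\mathrm{Dim}(\varphi\veebar\psi)\leq\mathrm{Dim}(\varphi)+\mathrm{Dim}(\psi)$. \end{itemize}
   Context: A $\Phi$-team is a set of maps $\Phi\to\{0,1\}$. A split of $T$ is $(T_1,T_2)$ with $T_1,T_2\subseteq T$, $T_1\cup T_2=T$. $\mathrm{PL}(\Sigma,\Phi)$-formulas are built from the $\Phi$-literals $\top,\bot,{\sim}\top,{\sim}\bot,p,\neg p,{\sim}p,{\sim}\neg p$ ($p\in\Phi$) by connectives in $\Sigma$. Semantics: $T\models\top$ always; $T\models\bot$ iff $T=\emptyset$; $T\models p$ iff $s(p)=1$ for all $s\in T$; $T\models\neg p$ iff $s(p)=0$ for all $s\in T$; $T\models{\sim}\ell$ iff $T\not\models\ell$; $\wedge$ conjunction; $T\models\psi\veebar\theta$ iff $T\models\psi$ or $T\models\theta$; $T\models\psi\vee\theta$ iff some split $(S,U)$ of $T$ has $S\models\psi,U\models\theta$. A generator of a formula $\varphi\in\mathrm{PL}(\Sigma,\Phi)$ is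 a set $\mathbb{G}$ of pairs $(S,U)$ of $\Phi$-teams with $S\subseteq U$ such that for every $\Phi$-team $T$: $T\models\varphi$ iff there is $(S,U)\in\mathbb{G}$ with $S\subseteq T\subseteq U$. The upper dimension of $\mathbb{G}$ is $\mathrm{Dim}(\mathbb{G})=|\{U:(S,U)\in\mathbb{G}\}|$, and $\mathrm{Dim}(\varphi)$ is the minimum of $\mathrm{Dim}(\mathbb{G})$ over all generators $\mathbb{G}$ of $\varphi$. -}

module Defs where

open import Data.Nat using (ℕ; zero; suc; _≤_)
open import Data.Bool using (Bool; true; false; if_then_else_)
import Data.Bool.Properties as BoolP
open import Data.Fin using (Fin)
open import Data.Vec using (Vec; []; _∷_; lookup)
open import Data.List using (List; length; map; deduplicate)
open import Data.List.Relation.Unary.All using (All)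
open import Data.List.Relation.Unary.Any using (Any)
open import Data.Product using (Σ; ∃; _×_; _,_; proj₁; proj₂)
import Data.Product.Properties as ProdP
open import Data.Sum using (_⊎_)
open import Data.Unit using () renaming (⊤ to Unit)
open import Relation.Nullary using (¬_)
open import Relation.Binary.PropositionalEquality using (_≡_)
open import Relation.Binary.Definitions using (DecidableEquality)

-- Φ = {p_0, …, p_{n-1}} is represented by Fin n.
-- A Φ-assignment s : Φ → {0,1} is a vector of booleans (true = 1).
Assignment : ℕ → Set
Assignment n = Vec Bool n

-- A Φ-team is a set of assignments, represented canonically by its full
-- truth table (a complete binary tree of depth n), so that propositional
-- equality of teams coincides with equality of the sets of assignments.
Team : ℕ → Set
Team zero    = Bool
Team (suc n) = Team n × Team n

member : ∀ {n} → Team n → Assignment n → Bool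
member {zero}  b       []      = b
member {suc n} (f , t) (x ∷ s) = if x then member t s else member f s

_∈T_ : ∀ {n} → Assignment n → Team n → Set
s ∈T T = member T s ≡ true

_⊆T_ : ∀ {n} → Team n → Team n → Set
S ⊆T U = ∀ s → s ∈T S → s ∈T U

_≟T_ : ∀ {n} → DecidableEquality (Team n)
_≟T_ {zero}  = BoolP._≟_
_≟T_ {suc n} = ProdP.≡-dec (_≟T_ {n}) (_≟T_ {n})

data Literal (n : ℕ) : Set where
  ⊤ℓ ⊥ℓ ∼⊤ ∼⊥     : Literal n
  pos neg ∼pos ∼neg : Fin n → Literal n

data Formula (n : ℕ) : Set where
  lit  : Literal n → Formula n
  _∧_  : Formula n → Formula n → Formula n
  _∨_  : Formula n → Formula n → Formula n
  _⊻_  : Formula n → Formula n → Formula n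

_⊨ℓ_ : ∀ {n} → Team n → Literal n → Set
T ⊨ℓ ⊤ℓ     = Unit
T ⊨ℓ ⊥ℓ     = ∀ s → ¬ (s ∈T T)
T ⊨ℓ ∼⊤     = ¬ (T ⊨ℓ ⊤ℓ)
T ⊨ℓ ∼⊥     = ¬ (T ⊨ℓ ⊥ℓ)
T ⊨ℓ pos i  = ∀ s → s ∈T T → lookup s i ≡ true
T ⊨ℓ neg i  = ∀ s → s ∈T T → lookup s i ≡ false
T ⊨ℓ ∼pos i = ¬ (T ⊨ℓ pos i)
T ⊨ℓ ∼neg i = ¬ (T ⊨ℓ neg i)

IsSplit : ∀ {n} → Team n → Team n → Team n → Set
IsSplit T S U = S ⊆T T × U ⊆T T × (∀ s → s ∈T T → s ∈T S ⊎ s ∈T U)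

_⊨_ : ∀ {n} → Team n → Formula n → Set
T ⊨ lit ℓ   = T ⊨ℓ ℓ
T ⊨ (φ ∧ ψ) = T ⊨ φ × T ⊨ ψ
T ⊨ (φ ∨ ψ) = Σ (Team _) λ S → Σ (Team _) λ U → IsSplit T S U × S ⊨ φ × U ⊨ ψ
T ⊨ (φ ⊻ ψ) = T ⊨ φ ⊎ T ⊨ ψ

-- A generator: a (necessarily finite, since there are finitely many teams)
-- set of pairs (S , U) with S ⊆ U, given as a list.
Generator : ℕ → Set
Generator n = List (Team n × Team n)

IsGenerator : ∀ {n} → Formula n → Generator n → Set
IsGenerator {n} φ G =
  All (λ p → proj₁ p ⊆T proj₂ p) G ×
  (∀ (T : Team n) →
     (T ⊨ φ → Any (λ p → proj₁ p ⊆T T × T ⊆T proj₂ p) G) ×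
     (Any (λ p → proj₁ p ⊆T T × T ⊆T proj₂ p) G → T ⊨ φ))

upperDim : ∀ {n} → Generator n → ℕ
upperDim G = length (deduplicate _≟T_ (map proj₂ G))

IsDim : ∀ {n} → Formula n → ℕ → Set
IsDim φ d =
  (Σ (Generator _) λ G → IsGenerator φ G × upperDim G ≡ d) ×
  (∀ G → IsGenerator φ G → d ≤ upperDim G)

-- Each literal is, up to logical equivalence, either "every assignment of T
-- satisfies P" (generated by the single pair (∅, {s ∣ P s})) or its negation
-- "some assignment of T falsifies P" (generated by the pairs ({s}, all
-- assignments) with P s false); in both cases there is one upper team.
-- Given generators G₁ of φ and G₂ of ψ, the pairs (S₁ ∪ S₂, U₁ ∩ U₂) with
-- S₁ ∪ S₂ ⊆ U₁ ∩ U₂ generate φ ∧ ψ, the pairs (S₁ ∪ S₂, U₁ ∪ U₂) generate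
-- φ ∨ ψ, and G₁ ++ G₂ generates φ ⊻ ψ. Counting the possible upper teams
-- gives the bounds.
module Submission where

open import Defs
open import Data.Nat using (ℕ; zero; suc; _≤_; _+_; _*_; s≤s; z≤n)
open import Data.Nat.Properties using (≤-trans; ≤-reflexive; module ≤-Reasoning)
open import Data.Bool using (Bool; true; false; not; _≟_) renaming (_∨_ to _||_; _∧_ to _&&_)
open import Data.Bool.Properties using (not-involutive)
open import Data.Fin using (Fin)
open import Data.Vec using ([]; _∷_; lookup)
open import Data.Vec.Properties using (≡-dec)
open import Data.List using (List; []; _∷_; _++_; [_]; map; length; filter; cartesianProductWith; deduplicate)
open import Data.List.Properties using (length-++; length-map; length-++-sucʳ)
open import Data.List.Membership.Propositional using (_∈_; find; lose)
open import Data.List.Membership.Propositional.Properties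
  using (∈-++⁺ˡ; ∈-++⁺ʳ; ∈-++⁻; ∈-map⁺; ∈-map⁻; ∈-∃++; ∈-filter⁺; ∈-filter⁻;
         ∈-deduplicate⁺; ∈-deduplicate⁻; ∈-cartesianProductWith⁺; ∈-cartesianProductWith⁻)
open import Data.List.Relation.Binary.Subset.Propositional using (_⊆_)
open import Data.List.Relation.Unary.Any using (Any; here; there)
import Data.List.Relation.Unary.All as All
open import Data.List.Relation.Unary.All.Properties using (¬All⇒Any¬)
open import Data.List.Relation.Unary.Unique.Propositional using (Unique)
open import Data.List.Relation.Unary.AllPairs using (_∷_)
open import Data.List.Relation.Unary.Unique.DecPropositional.Properties using (deduplicate-!)
open import Data.Product using (_×_; ∃; _,_; proj₁; proj₂)
open import Data.Sum using (_⊎_; inj₁; inj₂; [_,_]′)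
open import Data.Unit using (tt)
open import Function using (_∘_; case_of_)
open import Function.Bundles using (_⇔_; mk⇔; module Equivalence)
open import Function.Construct.Identity using (⇔-id)
open import Function.Related.TypeIsomorphisms using (¬-cong-⇔)
open import Relation.Nullary using (¬_; Dec; yes; does; contradiction)
open import Relation.Nullary.Decidable using (map′; _→-dec_; dec-true)
open import Relation.Unary using (Decidable)
open import Relation.Binary.PropositionalEquality using (_≡_; refl; sym; trans; cong; cong₂; subst)

private
  variable
    A B C : Set
    n : ℕ

length-cartesianProductWith : (f : A → B → C) (xs : List A) (ys : List B) →
  length (cartesianProductWith f xs ys) ≡ length xs * length ys
length-cartesianProductWith f []       ys = refl
length-cartesianProductWith f (x ∷ xs) ys = begin
  length (map (f x) ys ++ cartesianProductWith f xs ys)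
    ≡⟨ length-++ (map (f x) ys) ⟩
  length (map (f x) ys) + length (cartesianProductWith f xs ys)
    ≡⟨ cong₂ _+_ (length-map (f x) ys) (length-cartesianProductWith f xs ys) ⟩
  length ys + length xs * length ys ∎
  where open Relation.Binary.PropositionalEquality.≡-Reasoning

Unique-⊆⇒length-≤ : {xs ys : List A} → Unique xs → xs ⊆ ys → length xs ≤ length ys
Unique-⊆⇒length-≤ {xs = []}     _              _   = z≤n
Unique-⊆⇒length-≤ {xs = x ∷ xs} (x∉xs ∷ uniq) x∷xs⊆ys with ∈-∃++ (x∷xs⊆ys (here refl))
... | ys₁ , ys₂ , refl = begin
  suc (length xs)            ≤⟨ s≤s (Unique-⊆⇒length-≤ uniq xs⊆ys₁++ys₂) ⟩
  suc (length (ys₁ ++ ys₂))  ≡⟨ length-++-sucʳ ys₁ x ys₂ ⟨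
  length (ys₁ ++ x ∷ ys₂)    ∎
  where
  open ≤-Reasoning
  xs⊆ys₁++ys₂ : xs ⊆ ys₁ ++ ys₂
  xs⊆ys₁++ys₂ {z} z∈xs with ∈-++⁻ ys₁ (x∷xs⊆ys (there z∈xs))
  ... | inj₁ z∈ys₁          = ∈-++⁺ˡ z∈ys₁
  ... | inj₂ (here refl)    = contradiction refl (All.lookup x∉xs z∈xs)
  ... | inj₂ (there z∈ys₂)  = ∈-++⁺ʳ ys₁ z∈ys₂

allAssignments : ∀ n → List (Assignment n)
allAssignments zero    = [ [] ]
allAssignments (suc n) = cartesianProductWith _∷_ (false ∷ true ∷ []) (allAssignments n)

∈-allAssignments : (s : Assignment n) → s ∈ allAssignments n
∈-allAssignments []      = here refl
∈-allAssignments (b ∷ s) = ∈-cartesianProductWith⁺ _∷_ (∈-bools b) (∈-allAssignments s)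
  where
  ∈-bools : ∀ b → b ∈ false ∷ true ∷ []
  ∈-bools false = here refl
  ∈-bools true  = there (here refl)

∀-assignment? : {Q : Assignment n → Set} → Decidable Q → Dec (∀ s → Q s)
∀-assignment? Q? = map′ (λ all s → All.lookup all (∈-allAssignments s))
                        (λ ∀Q → All.tabulate (λ {s} _ → ∀Q s))
                        (All.all? Q? (allAssignments _))

tabulate : (Assignment n → Bool) → Team n
tabulate {zero}  f = f []
tabulate {suc n} f = tabulate (f ∘ (false ∷_)) , tabulate (f ∘ (true ∷_))

member-tabulate : (f : Assignment n → Bool) (s : Assignment n) → member (tabulate f) s ≡ f s
member-tabulate {zero}  f []          = refl
member-tabulate {suc n} f (false ∷ s) = member-tabulate (f ∘ (false ∷_)) s
member-tabulate {suc n} f (true ∷ s)  = member-tabulate (f ∘ (true ∷_)) s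

∈-tabulate⁺ : (f : Assignment n → Bool) {s : Assignment n} → f s ≡ true → s ∈T tabulate f
∈-tabulate⁺ f {s} fs = trans (member-tabulate f s) fs

∈-tabulate⁻ : (f : Assignment n → Bool) {s : Assignment n} → s ∈T tabulate f → f s ≡ true
∈-tabulate⁻ f {s} s∈ = trans (sym (member-tabulate f s)) s∈

∅T fullT : Team n
∅T    = tabulate (λ _ → false)
fullT = tabulate (λ _ → true)

_≟ₐ_ : (s t : Assignment n) → Dec (s ≡ t)
_≟ₐ_ = ≡-dec _≟_

singletonT : Assignment n → Team n
singletonT s = tabulate (λ t → does (t ≟ₐ s))

_∪T_ _∩T_ : Team n → Team n → Team n
X ∪T Y = tabulate (λ s → member X s || member Y s)
X ∩T Y = tabulate (λ s → member X s && member Y s)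

∈-singleton : (s : Assignment n) → s ∈T singletonT s
∈-singleton s = ∈-tabulate⁺ (λ t → does (t ≟ₐ s)) (dec-true (s ≟ₐ s) refl)

module _ {X : Team n} where

  ∅-⊆ : ∅T ⊆T X
  ∅-⊆ s s∈∅ = case ∈-tabulate⁻ (λ _ → false) {s} s∈∅ of λ ()

  ⊆-full : X ⊆T fullT
  ⊆-full s _ = ∈-tabulate⁺ (λ _ → true) {s} refl

  singleton-⊆ : ∀ {s} → s ∈T X → singletonT s ⊆T X
  singleton-⊆ {s} s∈X t t∈[s] = subst (_∈T X) (sym t≡s) s∈X
    where
    t≡s : t ≡ s
    t≡s with t ≟ₐ s | ∈-tabulate⁻ (λ t → does (t ≟ₐ s)) t∈[s]
    ... | yes t≡s | _ = t≡s

⊆-trans : {X Y Z : Team n} → X ⊆T Y → Y ⊆T Z → X ⊆T Z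
⊆-trans X⊆Y Y⊆Z s = Y⊆Z s ∘ X⊆Y s

module _ {X Y : Team n} where

  ⊆-∪ˡ : X ⊆T (X ∪T Y)
  ⊆-∪ˡ s s∈X = ∈-tabulate⁺ (λ s → member X s || member Y s)
    (subst (λ b → b || member Y s ≡ true) (sym s∈X) refl)

  ⊆-∪ʳ : Y ⊆T (X ∪T Y)
  ⊆-∪ʳ s s∈Y = ∈-tabulate⁺ (λ s → member X s || member Y s) (||-trueʳ (member X s) s∈Y)
    where
    ||-trueʳ : ∀ a {b} → b ≡ true → a || b ≡ true
    ||-trueʳ true  _    = refl
    ||-trueʳ false refl = refl

  ∈-∪⁻ : ∀ {s} → s ∈T (X ∪T Y) → s ∈T X ⊎ s ∈T Y
  ∈-∪⁻ {s} s∈X∪Y with member X s | ∈-tabulate⁻ (λ s → member X s || member Y s) s∈X∪Y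
  ... | true  | _     = inj₁ refl
  ... | false | s∈Y   = inj₂ s∈Y

  ∪-⊆ : {Z : Team n} → X ⊆T Z → Y ⊆T Z → (X ∪T Y) ⊆T Z
  ∪-⊆ X⊆Z Y⊆Z s = [ X⊆Z s , Y⊆Z s ]′ ∘ ∈-∪⁻

  ∩-⊆ : (X ∩T Y) ⊆T X × (X ∩T Y) ⊆T Y
  ∩-⊆ = (λ s → proj₁ ∘ &&-true⁻ s) , (λ s → proj₂ ∘ &&-true⁻ s)
    where
    &&-true⁻ : ∀ s → s ∈T (X ∩T Y) → s ∈T X × s ∈T Y
    &&-true⁻ s s∈ with member X s | member Y s | ∈-tabulate⁻ (λ s → member X s && member Y s) s∈
    ... | true | true | _ = refl , refl

  ∈-∩⁺ : ∀ {s} → s ∈T X → s ∈T Y → s ∈T (X ∩T Y)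
  ∈-∩⁺ s∈X s∈Y = ∈-tabulate⁺ (λ s → member X s && member Y s) (cong₂ _&&_ s∈X s∈Y)

  ⊆-∩ : {Z : Team n} → Z ⊆T X → Z ⊆T Y → Z ⊆T (X ∩T Y)
  ⊆-∩ Z⊆X Z⊆Y s s∈Z = ∈-∩⁺ (Z⊆X s s∈Z) (Z⊆Y s s∈Z)

∪-mono-⊆ : {X X′ Y Y′ : Team n} → X ⊆T X′ → Y ⊆T Y′ → (X ∪T Y) ⊆T (X′ ∪T Y′)
∪-mono-⊆ X⊆X′ Y⊆Y′ = ∪-⊆ (⊆-trans X⊆X′ ⊆-∪ˡ) (⊆-trans Y⊆Y′ ⊆-∪ʳ)

_⊆?_ : (X Y : Team n) → Dec (X ⊆T Y)
X ⊆? Y = ∀-assignment? (λ s → (member X s ≟ true) →-dec (member Y s ≟ true))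

Proper : Team n × Team n → Set
Proper p = proj₁ p ⊆T proj₂ p

proper? : Decidable (Proper {n})
proper? p = proj₁ p ⊆? proj₂ p

Between : Team n → Team n × Team n → Set
Between T p = proj₁ p ⊆T T × T ⊆T proj₂ p

-- IsGenerator φ is Generates (_⊨ φ) by definition.
Generates : (Team n → Set) → Generator n → Set
Generates {n} P G =
  All.All Proper G ×
  (∀ (T : Team n) → (P T → Any (Between T) G) × (Any (Between T) G → P T))

generates : {P : Team n → Set} {G : Generator n} →
  (∀ {p} → p ∈ G → Proper p) →
  (∀ T → P T → ∃ λ p → p ∈ G × Between T p) →
  (∀ {T p} → p ∈ G → Between T p → P T) →
  Generates P G
generates proper complete sound = All.tabulate proper , λ T →
  (λ PT → let _ , p∈G , T∈p = complete T PT in lose p∈G T∈p) ,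
  (λ T∈G → let _ , p∈G , T∈p = find T∈G in sound p∈G T∈p)

module Generates {P : Team n → Set} {G : Generator n} (g : Generates P G) where

  proper : ∀ {p} → p ∈ G → Proper p
  proper = All.lookup (proj₁ g)

  complete : ∀ {T} → P T → ∃ λ p → p ∈ G × Between T p
  complete {T} PT = find (proj₁ (proj₂ g T) PT)

  sound : ∀ {T p} → p ∈ G → Between T p → P T
  sound {T} p∈G T∈p = proj₂ (proj₂ g T) (lose p∈G T∈p)

generates-cong : {P Q : Team n → Set} {G : Generator n} →
  (∀ T → P T ⇔ Q T) → Generates P G → Generates Q G
generates-cong P⇔Q (proper , g) = proper , λ T →
  (proj₁ (g T) ∘ Equivalence.from (P⇔Q T)) , (Equivalence.to (P⇔Q T) ∘ proj₂ (g T))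

uppers : Generator n → List (Team n)
uppers G = deduplicate _≟T_ (map proj₂ G)

∈-uppers : {G : Generator n} {p : Team n × Team n} → p ∈ G → proj₂ p ∈ uppers G
∈-uppers p∈G = ∈-deduplicate⁺ _≟T_ (∈-map⁺ proj₂ p∈G)

upperDim-≤-length : (G : Generator n) (Us : List (Team n)) →
  (∀ {p} → p ∈ G → proj₂ p ∈ Us) → upperDim G ≤ length Us
upperDim-≤-length G Us upper∈Us = Unique-⊆⇒length-≤ (deduplicate-! _≟T_ (map proj₂ G)) uppers⊆Us
  where
  uppers⊆Us : uppers G ⊆ Us
  uppers⊆Us U∈ with ∈-map⁻ proj₂ (∈-deduplicate⁻ _≟T_ (map proj₂ G) U∈)
  ... | _ , p∈G , refl = upper∈Us p∈G

upperDim-constant : (G : Generator n) (U : Team n) → (∀ {p} → p ∈ G → proj₂ p ≡ U) → upperDim G ≤ 1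
upperDim-constant G U upper≡U = upperDim-≤-length G [ U ] (here ∘ upper≡U)

upperDim-filter : {Q : Team n × Team n → Set} (Q? : Decidable Q) (G : Generator n) →
  upperDim (filter Q? G) ≤ upperDim G
upperDim-filter Q? G = upperDim-≤-length (filter Q? G) (uppers G) (∈-uppers ∘ proj₁ ∘ ∈-filter⁻ Q?)

upperDim-++ : (G₁ G₂ : Generator n) → upperDim (G₁ ++ G₂) ≤ upperDim G₁ + upperDim G₂
upperDim-++ G₁ G₂ = ≤-trans
  (upperDim-≤-length (G₁ ++ G₂) (uppers G₁ ++ uppers G₂)
    ([ ∈-++⁺ˡ ∘ ∈-uppers , ∈-++⁺ʳ _ ∘ ∈-uppers ]′ ∘ ∈-++⁻ G₁))
  (≤-reflexive (length-++ (uppers G₁)))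

upperDim-cartesianProductWith :
  (f : Team n × Team n → Team n × Team n → Team n × Team n) (_∙_ : Team n → Team n → Team n) →
  (∀ p q → proj₂ (f p q) ≡ proj₂ p ∙ proj₂ q) →
  (G₁ G₂ : Generator n) → upperDim (cartesianProductWith f G₁ G₂) ≤ upperDim G₁ * upperDim G₂
upperDim-cartesianProductWith f _∙_ upper-f G₁ G₂ = ≤-trans
  (upperDim-≤-length (cartesianProductWith f G₁ G₂) (cartesianProductWith _∙_ (uppers G₁) (uppers G₂)) upper∈)
  (≤-reflexive (length-cartesianProductWith _∙_ (uppers G₁) (uppers G₂)))
  where
  upper∈ : ∀ {r} → r ∈ cartesianProductWith f G₁ G₂ →
    proj₂ r ∈ cartesianProductWith _∙_ (uppers G₁) (uppers G₂)
  upper∈ r∈ with ∈-cartesianProductWith⁻ f G₁ G₂ r∈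
  ... | p , q , p∈G₁ , q∈G₂ , refl =
    subst (_∈ _) (sym (upper-f p q)) (∈-cartesianProductWith⁺ _∙_ (∈-uppers p∈G₁) (∈-uppers q∈G₂))

Everywhere : (Assignment n → Bool) → Team n → Set
Everywhere P T = ∀ s → s ∈T T → P s ≡ true

everywhere-generator : (Assignment n → Bool) → Generator n
everywhere-generator P = [ (∅T , tabulate P) ]

everywhere-generates : (P : Assignment n → Bool) → Generates (Everywhere P) (everywhere-generator P)
everywhere-generates P = generates (λ { (here refl) → ∅-⊆ }) complete sound
  where
  complete : ∀ T → Everywhere P T → ∃ λ p → p ∈ everywhere-generator P × Between T p
  complete T PT = _ , here refl , ∅-⊆ , λ s s∈T → ∈-tabulate⁺ P (PT s s∈T)
  sound : ∀ {T p} → p ∈ everywhere-generator P → Between T p → Everywhere P T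
  sound (here refl) (_ , T⊆P) s s∈T = ∈-tabulate⁻ P (T⊆P s s∈T)

¬everywhere⇒counterexample : {P : Assignment n → Bool} {T : Team n} →
  ¬ Everywhere P T → ∃ λ s → s ∈T T × P s ≡ false
¬everywhere⇒counterexample {P = P} {T} ¬PT =
  let s , _ , ¬[s∈T⇒Ps] = find (¬All⇒Any¬ P? (allAssignments _) (¬PT ∘ fromAll))
  in s , counterexample (member T s) (P s) ¬[s∈T⇒Ps]
  where
  P? : Decidable (λ s → s ∈T T → P s ≡ true)
  P? s = (member T s ≟ true) →-dec (P s ≟ true)
  fromAll : All.All (λ s → s ∈T T → P s ≡ true) (allAssignments _) → Everywhere P T
  fromAll all s = All.lookup all (∈-allAssignments s)
  counterexample : ∀ a b → ¬ (a ≡ true → b ≡ true) → a ≡ true × b ≡ false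
  counterexample true  false _     = refl , refl
  counterexample true  true  ¬a⇒b  = contradiction (λ _ → refl) ¬a⇒b
  counterexample false _     ¬a⇒b  = contradiction (λ ()) ¬a⇒b

counterexamples : (Assignment n → Bool) → List (Assignment n)
counterexamples P = filter (λ s → P s ≟ false) (allAssignments _)

¬everywhere-generator : (Assignment n → Bool) → Generator n
¬everywhere-generator P = map (λ s → (singletonT s , fullT)) (counterexamples P)

¬everywhere-generates : (P : Assignment n → Bool) →
  Generates (λ T → ¬ Everywhere P T) (¬everywhere-generator P)
¬everywhere-generates P = generates proper complete sound
  where
  proper : ∀ {p} → p ∈ ¬everywhere-generator P → Proper p
  proper p∈G with ∈-map⁻ _ p∈G
  ... | _ , _ , refl = ⊆-full
  complete : ∀ T → ¬ Everywhere P T → ∃ λ p → p ∈ ¬everywhere-generator P × Between T p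
  complete T ¬PT =
    let s , s∈T , Ps≡false = ¬everywhere⇒counterexample ¬PT
    in _ , ∈-map⁺ _ (∈-filter⁺ (λ s → P s ≟ false) (∈-allAssignments s) Ps≡false) ,
       singleton-⊆ s∈T , ⊆-full
  sound : ∀ {T p} → p ∈ ¬everywhere-generator P → Between T p → ¬ Everywhere P T
  sound p∈G ([s]⊆T , _) PT with ∈-map⁻ _ p∈G
  ... | s , s∈counterexamples , refl =
    case trans (sym (PT s ([s]⊆T s (∈-singleton s))))
               (proj₂ (∈-filter⁻ (λ s → P s ≟ false) {xs = allAssignments _} s∈counterexamples)) of λ ()

everywhere⇔⊤ℓ : (T : Team n) → Everywhere (λ _ → true) T ⇔ (T ⊨ℓ ⊤ℓ)
everywhere⇔⊤ℓ T = mk⇔ (λ _ → tt) (λ _ _ _ → refl)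

everywhere⇔⊥ℓ : (T : Team n) → Everywhere (λ _ → false) T ⇔ (T ⊨ℓ ⊥ℓ)
everywhere⇔⊥ℓ T = mk⇔ (λ PT s s∈T → case PT s s∈T of λ ())
                      (λ ⊥T s s∈T → contradiction s∈T (⊥T s))

everywhere⇔neg : (i : Fin n) (T : Team n) → Everywhere (λ s → not (lookup s i)) T ⇔ (T ⊨ℓ neg i)
everywhere⇔neg i T = mk⇔ (λ PT s s∈T → not-true (PT s s∈T)) (λ ¬pT s s∈T → cong not (¬pT s s∈T))
  where
  not-true : ∀ {b} → not b ≡ true → b ≡ false
  not-true {b} nb≡true = trans (sym (not-involutive b)) (cong not nb≡true)

literal-shape : (ℓ : Literal n) → ∃ λ P →
  (∀ T → Everywhere P T ⇔ (T ⊨ℓ ℓ)) ⊎ (∀ T → (¬ Everywhere P T) ⇔ (T ⊨ℓ ℓ))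
literal-shape ⊤ℓ       = _ , inj₁ everywhere⇔⊤ℓ
literal-shape ⊥ℓ       = _ , inj₁ everywhere⇔⊥ℓ
literal-shape ∼⊤       = _ , inj₂ (¬-cong-⇔ ∘ everywhere⇔⊤ℓ)
literal-shape ∼⊥       = _ , inj₂ (¬-cong-⇔ ∘ everywhere⇔⊥ℓ)
literal-shape (pos i)  = _ , inj₁ (λ _ → ⇔-id _)
literal-shape (neg i)  = _ , inj₁ (everywhere⇔neg i)
literal-shape (∼pos i) = _ , inj₂ (λ _ → ⇔-id _)
literal-shape (∼neg i) = _ , inj₂ (¬-cong-⇔ ∘ everywhere⇔neg i)

literal-generator : (ℓ : Literal n) → ∃ λ G → IsGenerator (lit ℓ) G × upperDim G ≤ 1
literal-generator ℓ with literal-shape ℓ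
... | P , inj₁ P⇔ℓ  = _ , generates-cong P⇔ℓ (everywhere-generates P) ,
                      upperDim-constant (everywhere-generator P) (tabulate P) λ { (here refl) → refl }
... | P , inj₂ ¬P⇔ℓ = _ , generates-cong ¬P⇔ℓ (¬everywhere-generates P) ,
                      upperDim-constant _ fullT upper≡full
  where
  upper≡full : ∀ {p} → p ∈ ¬everywhere-generator P → proj₂ p ≡ fullT
  upper≡full p∈G with ∈-map⁻ _ p∈G
  ... | _ , _ , refl = refl

meet join : Team n × Team n → Team n × Team n → Team n × Team n
meet p q = (proj₁ p ∪T proj₁ q , proj₂ p ∩T proj₂ q)
join p q = (proj₁ p ∪T proj₁ q , proj₂ p ∪T proj₂ q)

_∧ᴳ_ _∨ᴳ_ _⊻ᴳ_ : Generator n → Generator n → Generator n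
G₁ ∧ᴳ G₂ = filter proper? (cartesianProductWith meet G₁ G₂)
G₁ ∨ᴳ G₂ = cartesianProductWith join G₁ G₂
G₁ ⊻ᴳ G₂ = G₁ ++ G₂

module _ {T : Team n} {p q : Team n × Team n} where

  between-meet⁺ : Between T p → Between T q → Between T (meet p q)
  between-meet⁺ (S₁⊆T , T⊆U₁) (S₂⊆T , T⊆U₂) = ∪-⊆ S₁⊆T S₂⊆T , ⊆-∩ T⊆U₁ T⊆U₂

  between-meet⁻ : Between T (meet p q) → Between T p × Between T q
  between-meet⁻ (S⊆T , T⊆U) = (⊆-trans ⊆-∪ˡ S⊆T , ⊆-trans T⊆U (proj₁ ∩-⊆)) ,
                              (⊆-trans ⊆-∪ʳ S⊆T , ⊆-trans T⊆U (proj₂ ∩-⊆))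

  between-join⁺ : {T₁ T₂ : Team n} → IsSplit T T₁ T₂ → Between T₁ p → Between T₂ q → Between T (join p q)
  between-join⁺ (T₁⊆T , T₂⊆T , T⊆T₁∪T₂) (S₁⊆T₁ , T₁⊆U₁) (S₂⊆T₂ , T₂⊆U₂) =
    ∪-⊆ (⊆-trans S₁⊆T₁ T₁⊆T) (⊆-trans S₂⊆T₂ T₂⊆T) ,
    λ s s∈T → [ ⊆-∪ˡ s ∘ T₁⊆U₁ s , ⊆-∪ʳ s ∘ T₂⊆U₂ s ]′ (T⊆T₁∪T₂ s s∈T)

  between-join⁻ : Proper p → Proper q → Between T (join p q) →
    IsSplit T (T ∩T proj₂ p) (T ∩T proj₂ q) × Between (T ∩T proj₂ p) p × Between (T ∩T proj₂ q) q
  between-join⁻ S₁⊆U₁ S₂⊆U₂ (S⊆T , T⊆U) =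
    (proj₁ ∩-⊆ , proj₁ ∩-⊆ , λ s s∈T →
      [ inj₁ ∘ ∈-∩⁺ {X = T} s∈T , inj₂ ∘ ∈-∩⁺ {X = T} s∈T ]′ (∈-∪⁻ {X = proj₂ p} (T⊆U s s∈T))) ,
    (⊆-∩ (⊆-trans ⊆-∪ˡ S⊆T) S₁⊆U₁ , proj₂ ∩-⊆) ,
    (⊆-∩ (⊆-trans ⊆-∪ʳ S⊆T) S₂⊆U₂ , proj₂ ∩-⊆)

module _ (φ ψ : Formula n) {G₁ G₂ : Generator n} (g₁ : IsGenerator φ G₁) (g₂ : IsGenerator ψ G₂) where
  private
    module g₁ = Generates g₁
    module g₂ = Generates g₂

  ∧ᴳ-generates : IsGenerator (φ ∧ ψ) (G₁ ∧ᴳ G₂)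
  ∧ᴳ-generates = generates (proj₂ ∘ ∈-filter⁻ proper? {xs = cartesianProductWith meet G₁ G₂}) complete sound
    where
    complete : ∀ T → T ⊨ (φ ∧ ψ) → ∃ λ r → r ∈ G₁ ∧ᴳ G₂ × Between T r
    complete T (φT , ψT) =
      let p , p∈G₁ , T∈p = g₁.complete φT
          q , q∈G₂ , T∈q = g₂.complete ψT
          S⊆T , T⊆U      = between-meet⁺ T∈p T∈q
      in _ , ∈-filter⁺ proper? (∈-cartesianProductWith⁺ meet p∈G₁ q∈G₂) (⊆-trans S⊆T T⊆U) , S⊆T , T⊆U
    sound : ∀ {T r} → r ∈ G₁ ∧ᴳ G₂ → Between T r → T ⊨ (φ ∧ ψ)
    sound r∈ T∈r with ∈-cartesianProductWith⁻ meet G₁ G₂ (proj₁ (∈-filter⁻ proper? r∈))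
    ... | _ , _ , p∈G₁ , q∈G₂ , refl =
      let T∈p , T∈q = between-meet⁻ T∈r in g₁.sound p∈G₁ T∈p , g₂.sound q∈G₂ T∈q

  ∨ᴳ-generates : IsGenerator (φ ∨ ψ) (G₁ ∨ᴳ G₂)
  ∨ᴳ-generates = generates proper complete sound
    where
    proper : ∀ {r} → r ∈ G₁ ∨ᴳ G₂ → Proper r
    proper r∈ with ∈-cartesianProductWith⁻ join G₁ G₂ r∈
    ... | _ , _ , p∈G₁ , q∈G₂ , refl = ∪-mono-⊆ (g₁.proper p∈G₁) (g₂.proper q∈G₂)
    complete : ∀ T → T ⊨ (φ ∨ ψ) → ∃ λ r → r ∈ G₁ ∨ᴳ G₂ × Between T r
    complete T (_ , _ , split , φT₁ , ψT₂) =
      let p , p∈G₁ , T₁∈p = g₁.complete φT₁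
          q , q∈G₂ , T₂∈q = g₂.complete ψT₂
      in _ , ∈-cartesianProductWith⁺ join p∈G₁ q∈G₂ , between-join⁺ split T₁∈p T₂∈q
    sound : ∀ {T r} → r ∈ G₁ ∨ᴳ G₂ → Between T r → T ⊨ (φ ∨ ψ)
    sound r∈ T∈r with ∈-cartesianProductWith⁻ join G₁ G₂ r∈
    ... | _ , _ , p∈G₁ , q∈G₂ , refl =
      let split , T₁∈p , T₂∈q = between-join⁻ (g₁.proper p∈G₁) (g₂.proper q∈G₂) T∈r
      in _ , _ , split , g₁.sound p∈G₁ T₁∈p , g₂.sound q∈G₂ T₂∈q

  ⊻ᴳ-generates : IsGenerator (φ ⊻ ψ) (G₁ ⊻ᴳ G₂)
  ⊻ᴳ-generates = generates
    ([ g₁.proper , g₂.proper ]′ ∘ ∈-++⁻ G₁)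
    (λ { T (inj₁ φT) → let p , p∈G₁ , T∈p = g₁.complete φT in p , ∈-++⁺ˡ p∈G₁ , T∈p
       ; T (inj₂ ψT) → let q , q∈G₂ , T∈q = g₂.complete ψT in q , ∈-++⁺ʳ G₁ q∈G₂ , T∈q })
    (λ r∈ T∈r → [ (λ p∈G₁ → inj₁ (g₁.sound p∈G₁ T∈r)) , (λ q∈G₂ → inj₂ (g₂.sound q∈G₂ T∈r)) ]′
                  (∈-++⁻ G₁ r∈))

upperDim-∧ᴳ : (G₁ G₂ : Generator n) → upperDim (G₁ ∧ᴳ G₂) ≤ upperDim G₁ * upperDim G₂
upperDim-∧ᴳ G₁ G₂ = ≤-trans (upperDim-filter proper? (cartesianProductWith meet G₁ G₂))
                            (upperDim-cartesianProductWith meet _∩T_ (λ _ _ → refl) G₁ G₂)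

upperDim-∨ᴳ : (G₁ G₂ : Generator n) → upperDim (G₁ ∨ᴳ G₂) ≤ upperDim G₁ * upperDim G₂
upperDim-∨ᴳ = upperDim-cartesianProductWith join _∪T_ (λ _ _ → refl)

dim-≤ : (φ : Formula n) {d m : ℕ} (G : Generator n) → IsDim φ d → IsGenerator φ G → upperDim G ≤ m → d ≤ m
dim-≤ φ G (_ , minimal) g G≤m = ≤-trans (minimal G g) G≤m

connective-dim-≤ :
  (_⊙_ : Formula n → Formula n → Formula n) (_⊙ᴳ_ : Generator n → Generator n → Generator n) (_⊕_ : ℕ → ℕ → ℕ) →
  (∀ φ ψ {G₁ G₂} → IsGenerator φ G₁ → IsGenerator ψ G₂ → IsGenerator (φ ⊙ ψ) (G₁ ⊙ᴳ G₂)) →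
  (∀ G₁ G₂ → upperDim (G₁ ⊙ᴳ G₂) ≤ upperDim G₁ ⊕ upperDim G₂) →
  ∀ (φ ψ : Formula n) d₁ d₂ d → IsDim φ d₁ → IsDim ψ d₂ → IsDim (φ ⊙ ψ) d → d ≤ d₁ ⊕ d₂
connective-dim-≤ _⊙_ _⊙ᴳ_ _⊕_ ⊙ᴳ-generates upperDim-⊙ᴳ φ ψ _ _ _
  ((G₁ , g₁ , refl) , _) ((G₂ , g₂ , refl) , _) dim =
  dim-≤ (φ ⊙ ψ) (G₁ ⊙ᴳ G₂) dim (⊙ᴳ-generates φ ψ g₁ g₂) (upperDim-⊙ᴳ G₁ G₂)

lemma3p12 : (n : ℕ) →
    (∀ (ℓ : Literal n) d → IsDim (lit ℓ) d → d ≤ 1) ×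
    (∀ (φ ψ : Formula n) d₁ d₂ d → IsDim φ d₁ → IsDim ψ d₂ → IsDim (φ ∧ ψ) d → d ≤ d₁ * d₂) ×
    (∀ (φ ψ : Formula n) d₁ d₂ d → IsDim φ d₁ → IsDim ψ d₂ → IsDim (φ ∨ ψ) d → d ≤ d₁ * d₂) ×
    (∀ (φ ψ : Formula n) d₁ d₂ d → IsDim φ d₁ → IsDim ψ d₂ → IsDim (φ ⊻ ψ) d → d ≤ d₁ + d₂)
lemma3p12 n =
  literal-bound ,
  connective-dim-≤ _∧_ _∧ᴳ_ _*_ ∧ᴳ-generates upperDim-∧ᴳ ,
  connective-dim-≤ _∨_ _∨ᴳ_ _*_ ∨ᴳ-generates upperDim-∨ᴳ ,
  connective-dim-≤ _⊻_ _⊻ᴳ_ _+_ ⊻ᴳ-generates upperDim-++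
  where
  literal-bound : ∀ (ℓ : Literal n) d → IsDim (lit ℓ) d → d ≤ 1
  literal-bound ℓ d dimℓ = let G , g , G≤1 = literal-generator ℓ in dim-≤ (lit ℓ) G dimℓ g G≤1
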